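{- For $N\in\mathbb{N}$ and $t\in\mathcal{D}_N$, the holomorphic eta quotient $\eta^{B_N(\cdot,t)}$ is not factorizable on $\Gamma_0(N)$.
   Context: Let $\eta(z)=q^{1/24}\prod_{n\ge1}(1-q^n)$, $q=e^{2\pi i z}$, $z$ in the upper half plane, $\eta_d(z)=\eta(dz)$. Let $\mathcal{D}_N$ be the set of positive divisors of $N$ and $\eta^X=\prod_{d\in\mathcal{D}_N}\eta_d^{X_d}$ for $X\in\mathbb{Z}^{\mathcal{D}_N}$. Let $A_N(t,d)=\frac{N\gcd(d,t)^2}{d\gcd(t^2,N)}$ for $t,d\in\mathcal{D}_N$ (invertible over $\mathbb{Q}$); $\eta^X$ is holomorphic (no poles at cusps of $\Gamma_0(N)$) iff $A_NX\ge0$ componentwise. A holomorphic eta quotient $f$ is factorizable on $\Gamma_0(N)$ if $f=gh$ with $g,h$ nonconstant holomorphic eta quotients of level dividing $N$ (the level of $\prod_d\eta_d^{X_d}$ being $\operatorname{lcm}\{d:X_d\ne0\}$). For $t\in\mathcal{D}_N$ let $m_{t,N}$ be the smallest positive integer with $m_{t,N}A_N^{ -1}(\cdot,t)\in\mathbb{Z}^{\mathcal{D}_N}$ ($A_N^{ -1}(\cdot,t)$ the column indexed by $t$), and $B_N(\cdot,t)=m_{t,N}A_N^{ -1}(\cdot,t)$. -}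

module Defs where

open import Data.Nat as ℕ using (ℕ; zero; suc; _≟_)
open import Data.Nat.Divisibility using (_∣_; _∣?_)
open import Data.Nat.GCD using (gcd)
open import Data.Integer as ℤ using (ℤ; +_)
open import Data.Rational as ℚ using (ℚ; 0ℚ; 1ℚ; _/_)
open import Data.List using (List; filter; upTo; foldr; map)
open import Data.List.Membership.Propositional using (_∈_)
open import Data.Product using (Σ; ∃; _×_)
open import Relation.Nullary using (¬_; yes; no)
open import Relation.Binary.PropositionalEquality using (_≡_; _≢_)

-- The set 𝒟_N of positive divisors of N (for N ≥ 1), as a list 0..N filtered by d ∣ N
-- (0 ∣ N fails for N ≥ 1, so only positive divisors remain).
𝒟 : ℕ → List ℕ
𝒟 N = filter (_∣? N) (upTo (suc N))

-- Exponent vectors X ∈ ℤ^{𝒟_N}: functions ℕ → ℤ, only values at divisors matter.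
Vecℤ : Set
Vecℤ = ℕ → ℤ

-- natural-number fraction as a rational (convention: n // 0 = 0; never used at 0 here)
_//_ : ℕ → ℕ → ℚ
n // zero = 0ℚ
n // suc k = (+ n) / suc k

ℤtoℚ : ℤ → ℚ
ℤtoℚ z = z / 1

ℕtoℚ : ℕ → ℚ
ℕtoℚ n = (+ n) / 1

Σ𝒟 : ℕ → (ℕ → ℚ) → ℚ
Σ𝒟 N f = foldr ℚ._+_ 0ℚ (map f (𝒟 N))

A : ℕ → ℕ → ℕ → ℚ
A N t d = (N ℕ.* (gcd d t ℕ.* gcd d t)) // (d ℕ.* gcd (t ℕ.* t) N)

Aapply : ℕ → (ℕ → ℚ) → ℕ → ℚ
Aapply N X t = Σ𝒟 N (λ d → A N t d ℚ.* X d)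

-- η^X is holomorphic on Γ₀(N)  iff  A_N X ≥ 0 componentwise
Holomorphic : ℕ → Vecℤ → Set
Holomorphic N X = ∀ t → t ∈ 𝒟 N → 0ℚ ℚ.≤ Aapply N (λ d → ℤtoℚ (X d)) t

-- η^Y is nonconstant (i.e. Y ≠ 0 as an element of ℤ^{𝒟_N})
Nonconstant : ℕ → Vecℤ → Set
Nonconstant N Y = Σ ℕ λ d → d ∈ 𝒟 N × Y d ≢ + 0

-- η^X is factorizable on Γ₀(N): X = Y + Z with η^Y, η^Z nonconstant holomorphic
-- eta quotients of level dividing N (i.e. exponent vectors supported on 𝒟_N).
Factorizable : ℕ → Vecℤ → Set
Factorizable N X =
  Σ Vecℤ λ Y → Σ Vecℤ λ Z →
    (∀ d → d ∈ 𝒟 N → X d ≡ Y d ℤ.+ Z d) ×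
    Holomorphic N Y × Holomorphic N Z × Nonconstant N Y × Nonconstant N Z

δ : ℕ → ℕ → ℚ
δ s t with s ≟ t
... | yes _ = 1ℚ
... | no _ = 0ℚ

IsInvColumn : ℕ → ℕ → (ℕ → ℚ) → Set
IsInvColumn N t v = ∀ s → s ∈ 𝒟 N → Aapply N v s ≡ δ s t

IsIntegral : ℚ → Set
IsIntegral q = ∃ λ (z : ℤ) → q ≡ ℤtoℚ z

IntegralMultiple : ℕ → (ℕ → ℚ) → ℕ → Set
IntegralMultiple N v m = ∀ d → d ∈ 𝒟 N → IsIntegral (ℕtoℚ m ℚ.* v d)

IsMinimalDenominator : ℕ → (ℕ → ℚ) → ℕ → Set
IsMinimalDenominator N v m =
  1 ℕ.≤ m × IntegralMultiple N v m ×
  (∀ m′ → 1 ℕ.≤ m′ → IntegralMultiple N v m′ → m ℕ.≤ m′)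

IsB : ℕ → ℕ → Vecℤ → Set
IsB N t X =
  Σ (ℕ → ℚ) λ v → Σ ℕ λ m →
    IsInvColumn N t v × IsMinimalDenominator N v m ×
    (∀ d → d ∈ 𝒟 N → ℤtoℚ (X d) ≡ ℕtoℚ m ℚ.* v d)

{-# OPTIONS --safe #-}
-- Write A = A_N and e_t for the t-th unit vector. Then A X = m e_t ≥ 0, so η^X is holomorphic.
-- If X = Y + Z with η^Y, η^Z holomorphic, then A Y, A Z ≥ 0 add up to m e_t, so A Y = a e_t and
-- A Z = b e_t with a + b = m, and injectivity of A gives Y = a A⁻¹(·,t), Z = b A⁻¹(·,t). The entries
-- of A are integers, so a, b ∈ ℕ; they are nonzero as Y, Z are nonconstant, and then minimality of
-- m gives m ≤ a and m ≤ b, which is absurd.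
-- For injectivity, A(t,d) = (N / gcd(t², N)) gcd(d,t)² (1 / d), and (gcd(d,t)²) is a Gram matrix:
-- gcd(d,t) counts the z mod N killed by both t and d. A kernel vector x of a Gram matrix is
-- orthogonal to every Gram vector, and here this says Σ_{t : s ∣ t} x_t = 0 for all s ∣ N; downward
-- induction on s then gives x = 0.
module Submission where

open import Defs
open import Data.Nat as ℕ using (ℕ; zero; suc; NonZero; _≤_; _<_; s≤s; z≤n; _+_; _*_)
import Data.Nat.Properties as ℕ
open import Data.Nat.Divisibility
open import Data.Nat.GCD
open import Data.Integer as ℤ using (+_; -[1+_])
import Data.Integer.Properties as ℤ
open import Data.Rational as ℚ using (ℚ; 0ℚ; 1ℚ; fromℚᵘ)
import Data.Rational.Properties as ℚ
open import Data.Rational.Unnormalised as ℚᵘ using (mkℚᵘ; *≡*)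
import Data.Rational.Unnormalised.Properties as ℚᵘ
open import Data.Rational.Solver using (module +-*-Solver)
open import Data.List using (List; []; _∷_; _++_; map; foldr; upTo; applyUpTo; cartesianProduct)
import Data.List.Properties as List
open import Data.List.Membership.Propositional using (_∈_)
open import Data.List.Membership.Propositional.Properties using (∈-filter⁻; ∈-upTo⁺; ∈-upTo⁻; ∈-cartesianProduct⁺)
open import Data.List.Relation.Unary.Any using (here; there)
import Data.List.Relation.Unary.All as All
open import Data.List.Relation.Unary.AllPairs using (_∷_)
open import Data.List.Relation.Unary.Unique.Propositional using (Unique)
import Data.List.Relation.Unary.Unique.Propositional.Properties as Unique
open import Data.Product using (∃-syntax; _×_; _,_; proj₁; proj₂)
open import Data.Sum using (inj₁; inj₂)
open import Function using (_∘_)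
open import Relation.Nullary using (¬_; Dec; yes; no; contradiction)
open import Relation.Binary.PropositionalEquality
  using (_≡_; _≢_; refl; sym; trans; cong; cong₂; subst; subst₂; ≢-sym; module ≡-Reasoning)
open ≡-Reasoning

private variable I J : Set

-- Arithmetic in ℚ

fromℚᵘ-homo-+ : ∀ p q → fromℚᵘ (p ℚᵘ.+ q) ≡ fromℚᵘ p ℚ.+ fromℚᵘ q
fromℚᵘ-homo-+ p q = ℚ.toℚᵘ-injective (ℚᵘ.≃-trans (ℚ.toℚᵘ-fromℚᵘ (p ℚᵘ.+ q))
  (ℚᵘ.≃-trans (ℚᵘ.+-cong (ℚᵘ.≃-sym (ℚ.toℚᵘ-fromℚᵘ p)) (ℚᵘ.≃-sym (ℚ.toℚᵘ-fromℚᵘ q)))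
              (ℚᵘ.≃-sym (ℚ.toℚᵘ-homo-+ (fromℚᵘ p) (fromℚᵘ q)))))

fromℚᵘ-homo-* : ∀ p q → fromℚᵘ (p ℚᵘ.* q) ≡ fromℚᵘ p ℚ.* fromℚᵘ q
fromℚᵘ-homo-* p q = ℚ.toℚᵘ-injective (ℚᵘ.≃-trans (ℚ.toℚᵘ-fromℚᵘ (p ℚᵘ.* q))
  (ℚᵘ.≃-trans (ℚᵘ.*-cong (ℚᵘ.≃-sym (ℚ.toℚᵘ-fromℚᵘ p)) (ℚᵘ.≃-sym (ℚ.toℚᵘ-fromℚᵘ q)))
              (ℚᵘ.≃-sym (ℚ.toℚᵘ-homo-* (fromℚᵘ p) (fromℚᵘ q)))))

ℤtoℚ-homo-+ : ∀ a b → ℤtoℚ (a ℤ.+ b) ≡ ℤtoℚ a ℚ.+ ℤtoℚ b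
ℤtoℚ-homo-+ a b =
  trans (ℚ.fromℚᵘ-cong {mkℚᵘ (a ℤ.+ b) 0} {mkℚᵘ a 0 ℚᵘ.+ mkℚᵘ b 0} (*≡* a+b≡a*1+b*1))
        (fromℚᵘ-homo-+ (mkℚᵘ a 0) (mkℚᵘ b 0))
  where
  a+b≡a*1+b*1 : (a ℤ.+ b) ℤ.* + 1 ≡ (a ℤ.* + 1 ℤ.+ b ℤ.* + 1) ℤ.* + 1
  a+b≡a*1+b*1 = cong (ℤ._* + 1) (cong₂ ℤ._+_ (sym (ℤ.*-identityʳ a)) (sym (ℤ.*-identityʳ b)))

ℤtoℚ-homo-* : ∀ a b → ℤtoℚ (a ℤ.* b) ≡ ℤtoℚ a ℚ.* ℤtoℚ b
ℤtoℚ-homo-* a b = fromℚᵘ-homo-* (mkℚᵘ a 0) (mkℚᵘ b 0)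

ℤtoℚ-injective : ∀ {a b} → ℤtoℚ a ≡ ℤtoℚ b → a ≡ b
ℤtoℚ-injective {a} {b} eq with ℚ.fromℚᵘ-injective {mkℚᵘ a 0} {mkℚᵘ b 0} eq
... | *≡* a*1≡b*1 = trans (sym (ℤ.*-identityʳ a)) (trans a*1≡b*1 (ℤ.*-identityʳ b))

ℕtoℚ-homo-+ : ∀ m n → ℕtoℚ (m + n) ≡ ℕtoℚ m ℚ.+ ℕtoℚ n
ℕtoℚ-homo-+ m n = trans (cong ℤtoℚ (ℤ.pos-+ m n)) (ℤtoℚ-homo-+ (+ m) (+ n))

ℕtoℚ-injective : ∀ {m n} → ℕtoℚ m ≡ ℕtoℚ n → m ≡ n
ℕtoℚ-injective eq = ℤ.+-injective (ℤtoℚ-injective eq)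

//-* : ∀ a b c d .{{_ : NonZero c}} .{{_ : NonZero d}} → (a * b) // (c * d) ≡ (a // c) ℚ.* (b // d)
//-* a b (suc c) (suc d) =
  trans (ℚ.fromℚᵘ-cong {mkℚᵘ (+ (a * b)) (d + c * suc d)} {mkℚᵘ (+ a) c ℚᵘ.* mkℚᵘ (+ b) d}
                       (*≡* (cong (ℤ._* + (suc c * suc d)) (ℤ.pos-* a b))))
        (fromℚᵘ-homo-* (mkℚᵘ (+ a) c) (mkℚᵘ (+ b) d))

//-cross : ∀ a b c d .{{_ : NonZero c}} .{{_ : NonZero d}} → a * d ≡ b * c → a // c ≡ b // d
//-cross a b (suc c) (suc d) eq = ℚ.fromℚᵘ-cong {mkℚᵘ (+ a) c} {mkℚᵘ (+ b) d}
  (*≡* (trans (sym (ℤ.pos-* a (suc d))) (trans (cong +_ eq) (ℤ.pos-* b (suc c)))))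

//-nonneg : ∀ a c → 0ℚ ℚ.≤ a // c
//-nonneg a zero    = ℚ.≤-refl
//-nonneg a (suc c) = ℚ.nonNegative⁻¹ _ {{ℚ.normalize-nonNeg a (suc c)}}

//-nonzero : ∀ a c .{{_ : NonZero a}} .{{_ : NonZero c}} → a // c ≢ 0ℚ
//-nonzero a (suc c) eq = ℚ.<-irrefl (sym eq) (ℚ.positive⁻¹ _ {{ℚ.normalize-pos a (suc c)}})

*//-cancelʳ : ∀ q c .{{_ : NonZero c}} → (q * c) // c ≡ ℕtoℚ q
*//-cancelʳ q c = //-cross (q * c) q c 1 (ℕ.*-identityʳ (q * c))

ℕtoℚ-homo-* : ∀ m n → ℕtoℚ (m * n) ≡ ℕtoℚ m ℚ.* ℕtoℚ n
ℕtoℚ-homo-* m n = //-* m n 1 1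

p≢0∧p*q≡0⇒q≡0 : ∀ {p q} → p ≢ 0ℚ → p ℚ.* q ≡ 0ℚ → q ≡ 0ℚ
p≢0∧p*q≡0⇒q≡0 {p} {q} p≢0 pq≡0 = begin
  q                      ≡⟨ ℚ.*-identityˡ q ⟨
  1ℚ ℚ.* q               ≡⟨ cong (ℚ._* q) (ℚ.*-inverseˡ p) ⟨
  (ℚ.1/ p ℚ.* p) ℚ.* q   ≡⟨ ℚ.*-assoc (ℚ.1/ p) p q ⟩
  ℚ.1/ p ℚ.* (p ℚ.* q)   ≡⟨ cong (ℚ.1/ p ℚ.*_) pq≡0 ⟩
  ℚ.1/ p ℚ.* 0ℚ          ≡⟨ ℚ.*-zeroʳ (ℚ.1/ p) ⟩
  0ℚ                     ∎
  where instance
    p-nonZero : ℚ.NonZero p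
    p-nonZero = ℚ.≢-nonZero p≢0

p*p≡0⇒p≡0 : ∀ p → p ℚ.* p ≡ 0ℚ → p ≡ 0ℚ
p*p≡0⇒p≡0 p pp≡0 with p ℚ.≟ 0ℚ
... | yes p≡0 = p≡0
... | no  p≢0 = p≢0∧p*q≡0⇒q≡0 p≢0 pp≡0

0≤p*q : ∀ {p q} → 0ℚ ℚ.≤ p → 0ℚ ℚ.≤ q → 0ℚ ℚ.≤ p ℚ.* q
0≤p*q {p} {q} 0≤p 0≤q =
  ℚ.nonNegative⁻¹ _ {{ℚ.nonNeg*nonNeg⇒nonNeg p {{ℚ.nonNegative 0≤p}} q {{ℚ.nonNegative 0≤q}}}}

0≤p*p : ∀ p → 0ℚ ℚ.≤ p ℚ.* p
0≤p*p p with ℚ.≤-total 0ℚ p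
... | inj₁ 0≤p = 0≤p*q 0≤p 0≤p
... | inj₂ p≤0 =
  ℚ.nonNegative⁻¹ _ {{ℚ.nonPos*nonPos⇒nonPos p {{ℚ.nonPositive p≤0}} p {{ℚ.nonPositive p≤0}}}}

0≤p+q : ∀ {p q} → 0ℚ ℚ.≤ p → 0ℚ ℚ.≤ q → 0ℚ ℚ.≤ p ℚ.+ q
0≤p+q 0≤p 0≤q = ℚ.+-mono-≤ 0≤p 0≤q

p+q≡0⇒p≡0 : ∀ {p q} → 0ℚ ℚ.≤ p → 0ℚ ℚ.≤ q → p ℚ.+ q ≡ 0ℚ → p ≡ 0ℚ
p+q≡0⇒p≡0 {p} {q} 0≤p 0≤q p+q≡0 = ℚ.≤-antisym p≤0 0≤p
  where
  p≤0 : p ℚ.≤ 0ℚ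
  p≤0 = ℚ.≤-trans (ℚ.≤-reflexive (sym (ℚ.+-identityʳ p)))
                  (ℚ.≤-trans (ℚ.+-monoʳ-≤ p 0≤q) (ℚ.≤-reflexive p+q≡0))

p+q≡0⇒q≡0 : ∀ {p q} → 0ℚ ℚ.≤ p → 0ℚ ℚ.≤ q → p ℚ.+ q ≡ 0ℚ → q ≡ 0ℚ
p+q≡0⇒q≡0 {p} {q} 0≤p 0≤q p+q≡0 = p+q≡0⇒p≡0 0≤q 0≤p (trans (ℚ.+-comm q p) p+q≡0)

nonneg-integral⇒ℕ : ∀ {p} → IsIntegral p → 0ℚ ℚ.≤ p → ∃[ n ] p ≡ ℕtoℚ n
nonneg-integral⇒ℕ (+ n , p≡n) _ = n , p≡n
nonneg-integral⇒ℕ (-[1+ n ] , refl) 0≤p = contradiction (ℚ.<-≤-trans p<0 0≤p) (ℚ.<-irrefl refl)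
  where
  p<0 : ℤtoℚ -[1+ n ] ℚ.< 0ℚ
  p<0 = ℚ.negative⁻¹ _ {{ℚ.neg-pos {ℚ.normalize (suc n) 1} (ℚ.normalize-pos (suc n) 1)}}

𝟙 : ∀ {P : Set} → Dec P → ℚ
𝟙 (yes _) = 1ℚ
𝟙 (no _)  = 0ℚ

𝟙-yes : ∀ {P : Set} (p : Dec P) → P → 𝟙 p ≡ 1ℚ
𝟙-yes (yes _) _  = refl
𝟙-yes (no ¬P) P = contradiction P ¬P

𝟙-no : ∀ {P : Set} (p : Dec P) → ¬ P → 𝟙 p ≡ 0ℚ
𝟙-no (yes P) ¬P = contradiction P ¬P
𝟙-no (no _)  _  = refl

𝟙-nonneg : ∀ {P : Set} (p : Dec P) → 0ℚ ℚ.≤ 𝟙 p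
𝟙-nonneg (yes _) = ℚ.nonNegative⁻¹ 1ℚ
𝟙-nonneg (no _)  = ℚ.≤-refl

𝟙-cong : ∀ {P Q : Set} (p : Dec P) (q : Dec Q) → (P → Q) → (Q → P) → 𝟙 p ≡ 𝟙 q
𝟙-cong (yes P) q P→Q _ = sym (𝟙-yes q (P→Q P))
𝟙-cong (no ¬P) q _ Q→P = sym (𝟙-no q (¬P ∘ Q→P))

𝟙-* : ∀ {P Q R : Set} (p : Dec P) (q : Dec Q) (r : Dec R) →
      (P → Q → R) → (R → P) → (R → Q) → 𝟙 p ℚ.* 𝟙 q ≡ 𝟙 r
𝟙-* (yes P) (yes Q) r PQ→R _ _ = sym (𝟙-yes r (PQ→R P Q))
𝟙-* (yes _) (no ¬Q) r _ _ R→Q = sym (𝟙-no r (¬Q ∘ R→Q))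
𝟙-* (no ¬P) q       r _ R→P _ = trans (ℚ.*-zeroˡ (𝟙 q)) (sym (𝟙-no r (¬P ∘ R→P)))

δ≡𝟙 : ∀ s t → δ s t ≡ 𝟙 (s ℕ.≟ t)
δ≡𝟙 s t with s ℕ.≟ t
... | yes _ = refl
... | no _  = refl

δ-diag : ∀ t → δ t t ≡ 1ℚ
δ-diag t = trans (δ≡𝟙 t t) (𝟙-yes (t ℕ.≟ t) refl)

δ-off : ∀ {s t} → s ≢ t → δ s t ≡ 0ℚ
δ-off {s} {t} s≢t = trans (δ≡𝟙 s t) (𝟙-no (s ℕ.≟ t) s≢t)

δ-nonneg : ∀ s t → 0ℚ ℚ.≤ δ s t
δ-nonneg s t = subst (0ℚ ℚ.≤_) (sym (δ≡𝟙 s t)) (𝟙-nonneg (s ℕ.≟ t))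

-- Finite sums and Gram matrices

∑ : List I → (I → ℚ) → ℚ
∑ l f = foldr ℚ._+_ 0ℚ (map f l)

∑-cong : ∀ (l : List I) {f g} → (∀ x → x ∈ l → f x ≡ g x) → ∑ l f ≡ ∑ l g
∑-cong []      f≗g = refl
∑-cong (x ∷ l) f≗g = cong₂ ℚ._+_ (f≗g x (here refl)) (∑-cong l (λ y y∈l → f≗g y (there y∈l)))

∑-zero : ∀ (l : List I) {f} → (∀ x → x ∈ l → f x ≡ 0ℚ) → ∑ l f ≡ 0ℚ
∑-zero []      f≗0 = refl
∑-zero (x ∷ l) f≗0 = cong₂ ℚ._+_ (f≗0 x (here refl)) (∑-zero l (λ y y∈l → f≗0 y (there y∈l)))

∑-++ : ∀ (l k : List I) f → ∑ (l ++ k) f ≡ ∑ l f ℚ.+ ∑ k f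
∑-++ []      k f = sym (ℚ.+-identityˡ (∑ k f))
∑-++ (x ∷ l) k f = trans (cong (f x ℚ.+_) (∑-++ l k f)) (sym (ℚ.+-assoc (f x) (∑ l f) (∑ k f)))

∑-map : ∀ (h : I → J) l f → ∑ (map h l) f ≡ ∑ l (f ∘ h)
∑-map h l f = cong (foldr ℚ._+_ 0ℚ) (sym (List.map-∘ l))

∑-+ : ∀ (l : List I) f g → ∑ l (λ x → f x ℚ.+ g x) ≡ ∑ l f ℚ.+ ∑ l g
∑-+ []      f g = refl
∑-+ (x ∷ l) f g = trans (cong ((f x ℚ.+ g x) ℚ.+_) (∑-+ l f g))
  (solve 4 (λ a b c d → (a :+ b) :+ (c :+ d) := (a :+ c) :+ (b :+ d)) refl (f x) (g x) (∑ l f) (∑ l g))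
  where open +-*-Solver

∑-*ˡ : ∀ (l : List I) c f → ∑ l (λ x → c ℚ.* f x) ≡ c ℚ.* ∑ l f
∑-*ˡ []      c f = sym (ℚ.*-zeroʳ c)
∑-*ˡ (x ∷ l) c f = trans (cong (c ℚ.* f x ℚ.+_) (∑-*ˡ l c f)) (sym (ℚ.*-distribˡ-+ c (f x) (∑ l f)))

∑-*ʳ : ∀ (l : List I) c f → ∑ l (λ x → f x ℚ.* c) ≡ ∑ l f ℚ.* c
∑-*ʳ l c f = trans (∑-cong l (λ x _ → ℚ.*-comm (f x) c)) (trans (∑-*ˡ l c f) (ℚ.*-comm c (∑ l f)))

∑-comm : ∀ (l : List I) (k : List J) (f : I → J → ℚ) →
         ∑ l (λ x → ∑ k (f x)) ≡ ∑ k (λ y → ∑ l (λ x → f x y))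
∑-comm []      k f = sym (∑-zero k (λ _ _ → refl))
∑-comm (x ∷ l) k f =
  trans (cong (∑ k (f x) ℚ.+_) (∑-comm l k f)) (sym (∑-+ k (f x) (λ y → ∑ l (λ x → f x y))))

∑-*-∑ : ∀ (l : List I) (k : List J) f g →
        ∑ l f ℚ.* ∑ k g ≡ ∑ (cartesianProduct l k) (λ (x , y) → f x ℚ.* g y)
∑-*-∑ []      k f g = ℚ.*-zeroˡ (∑ k g)
∑-*-∑ {I = I} {J = J} (x ∷ l) k f g = begin
  (f x ℚ.+ ∑ l f) ℚ.* ∑ k g                   ≡⟨ ℚ.*-distribʳ-+ (∑ k g) (f x) (∑ l f) ⟩
  f x ℚ.* ∑ k g ℚ.+ ∑ l f ℚ.* ∑ k g           ≡⟨ cong₂ ℚ._+_ (sym (∑-*ˡ k (f x) g)) (∑-*-∑ l k f g) ⟩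
  ∑ k (F ∘ (x ,_)) ℚ.+ ∑ l×k F                ≡⟨ cong (ℚ._+ ∑ l×k F) (sym (∑-map (x ,_) k F)) ⟩
  ∑ (map (x ,_) k) F ℚ.+ ∑ l×k F              ≡⟨ ∑-++ (map (x ,_) k) l×k F ⟨
  ∑ (cartesianProduct (x ∷ l) k) F            ∎
  where
  l×k : List (I × J)
  l×k = cartesianProduct l k
  F : I × J → ℚ
  F (x , y) = f x ℚ.* g y

∑-nonneg : ∀ (l : List I) {f} → (∀ x → x ∈ l → 0ℚ ℚ.≤ f x) → 0ℚ ℚ.≤ ∑ l f
∑-nonneg []      f≥0 = ℚ.≤-refl
∑-nonneg (x ∷ l) f≥0 = 0≤p+q (f≥0 x (here refl)) (∑-nonneg l (λ y y∈l → f≥0 y (there y∈l)))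

∑-nonneg≡0⇒≡0 : ∀ (l : List I) {f} → (∀ x → x ∈ l → 0ℚ ℚ.≤ f x) → ∑ l f ≡ 0ℚ →
                ∀ x → x ∈ l → f x ≡ 0ℚ
∑-nonneg≡0⇒≡0 (x ∷ l) {f} f≥0 ∑≡0 = λ where
    .x (here refl) → p+q≡0⇒p≡0 fx≥0 ∑l≥0 ∑≡0
    y  (there y∈l) → ∑-nonneg≡0⇒≡0 l f|l≥0 (p+q≡0⇒q≡0 fx≥0 ∑l≥0 ∑≡0) y y∈l
  where
  fx≥0 : 0ℚ ℚ.≤ f x
  fx≥0 = f≥0 x (here refl)
  f|l≥0 : ∀ y → y ∈ l → 0ℚ ℚ.≤ f y
  f|l≥0 y y∈l = f≥0 y (there y∈l)
  ∑l≥0 : 0ℚ ℚ.≤ ∑ l f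
  ∑l≥0 = ∑-nonneg l f|l≥0

∑-integral : ∀ (l : List I) {f} → (∀ x → x ∈ l → IsIntegral (f x)) → IsIntegral (∑ l f)
∑-integral []      _ = + 0 , refl
∑-integral (x ∷ l) f∈ℤ with f∈ℤ x (here refl) | ∑-integral l (λ y y∈l → f∈ℤ y (there y∈l))
... | a , fx≡a | b , ∑≡b = a ℤ.+ b , trans (cong₂ ℚ._+_ fx≡a ∑≡b) (sym (ℤtoℚ-homo-+ a b))

∑-single : ∀ {l : List I} {f s} → Unique l → s ∈ l → (∀ x → x ∈ l → x ≢ s → f x ≡ 0ℚ) →
           ∑ l f ≡ f s
∑-single {l = x ∷ l} {f} (x∉l ∷ _) (here refl) others =
  trans (cong (f x ℚ.+_) (∑-zero l (λ y y∈l → others y (there y∈l) (≢-sym (All.lookup x∉l y∈l)))))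
        (ℚ.+-identityʳ (f x))
∑-single {l = x ∷ l} {f} (x∉l ∷ unique) (there s∈l) others =
  trans (cong (ℚ._+ ∑ l f) (others x (here refl) (All.lookup x∉l s∈l)))
        (trans (ℚ.+-identityˡ (∑ l f)) (∑-single unique s∈l (λ y y∈l → others y (there y∈l))))

gram-quadratic-form : ∀ (D : List I) (P : List J) (e : I → J → ℚ) (x : I → ℚ) →
  let W = λ j → ∑ D (λ t → x t ℚ.* e t j) in
  ∑ D (λ t → x t ℚ.* ∑ D (λ d → ∑ P (λ j → e t j ℚ.* e d j) ℚ.* x d)) ≡ ∑ P (λ j → W j ℚ.* W j)
gram-quadratic-form {J = J} D P e x = begin
  ∑ D (λ t → x t ℚ.* ∑ D (λ d → ∑ P (λ j → e t j ℚ.* e d j) ℚ.* x d))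
    ≡⟨ ∑-cong D (λ t _ → cong (x t ℚ.*_) (inner t)) ⟩
  ∑ D (λ t → x t ℚ.* ∑ P (λ j → e t j ℚ.* W j))
    ≡⟨ ∑-cong D (λ t _ → trans (sym (∑-*ˡ P (x t) _))
                                (∑-cong P (λ j _ → sym (ℚ.*-assoc (x t) (e t j) (W j))))) ⟩
  ∑ D (λ t → ∑ P (λ j → (x t ℚ.* e t j) ℚ.* W j))
    ≡⟨ ∑-comm D P _ ⟩
  ∑ P (λ j → ∑ D (λ t → (x t ℚ.* e t j) ℚ.* W j))
    ≡⟨ ∑-cong P (λ j _ → ∑-*ʳ D (W j) (λ t → x t ℚ.* e t j)) ⟩
  ∑ P (λ j → W j ℚ.* W j) ∎
  where
  open +-*-Solver
  W : J → ℚ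
  W j = ∑ D (λ t → x t ℚ.* e t j)
  inner : ∀ t → ∑ D (λ d → ∑ P (λ j → e t j ℚ.* e d j) ℚ.* x d) ≡ ∑ P (λ j → e t j ℚ.* W j)
  inner t = begin
    ∑ D (λ d → ∑ P (λ j → e t j ℚ.* e d j) ℚ.* x d)
      ≡⟨ ∑-cong D (λ d _ → trans (sym (∑-*ʳ P (x d) _)) (∑-cong P (λ j _ →
           solve 3 (λ a b c → (a :* b) :* c := a :* (c :* b)) refl (e t j) (e d j) (x d)))) ⟩
    ∑ D (λ d → ∑ P (λ j → e t j ℚ.* (x d ℚ.* e d j)))
      ≡⟨ ∑-comm D P _ ⟩
    ∑ P (λ j → ∑ D (λ d → e t j ℚ.* (x d ℚ.* e d j)))
      ≡⟨ ∑-cong P (λ j _ → ∑-*ˡ D (e t j) _) ⟩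
    ∑ P (λ j → e t j ℚ.* W j) ∎

gram-kernel : ∀ (D : List I) (P : List J) (e : I → J → ℚ) (x : I → ℚ) →
  (∀ t → t ∈ D → ∑ D (λ d → ∑ P (λ j → e t j ℚ.* e d j) ℚ.* x d) ≡ 0ℚ) →
  ∀ j → j ∈ P → ∑ D (λ t → x t ℚ.* e t j) ≡ 0ℚ
gram-kernel {J = J} D P e x Γx≡0 j j∈P =
  p*p≡0⇒p≡0 (W j) (∑-nonneg≡0⇒≡0 P (λ j _ → 0≤p*p (W j)) ∑W²≡0 j j∈P)
  where
  W : J → ℚ
  W j = ∑ D (λ t → x t ℚ.* e t j)
  ∑W²≡0 : ∑ P (λ j → W j ℚ.* W j) ≡ 0ℚ
  ∑W²≡0 = trans (sym (gram-quadratic-form D P e x))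
                (∑-zero D (λ t t∈D → trans (cong (x t ℚ.*_) (Γx≡0 t t∈D)) (ℚ.*-zeroʳ (x t))))

-- The gcd² Gram matrix on the divisors of N

𝒟-unique : ∀ N → Unique (𝒟 N)
𝒟-unique N = Unique.filter⁺ (_∣? N) (Unique.upTo⁺ (suc N))

∈𝒟⇒∣ : ∀ {N t} → t ∈ 𝒟 N → t ∣ N
∈𝒟⇒∣ {N} t∈𝒟 = proj₂ (∈-filter⁻ (_∣? N) {xs = upTo (suc N)} t∈𝒟)

∈𝒟⇒≤ : ∀ {N t} → t ∈ 𝒟 N → t ≤ N
∈𝒟⇒≤ {N} t∈𝒟 = ℕ.≤-pred (∈-upTo⁻ (proj₁ (∈-filter⁻ (_∣? N) {xs = upTo (suc N)} t∈𝒟)))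

∈𝒟⇒nonZero : ∀ {N t} .{{_ : NonZero N}} → t ∈ 𝒟 N → NonZero t
∈𝒟⇒nonZero {N} t∈𝒟 = ℕ.≢-nonZero (λ { refl → ℕ.≢-nonZero⁻¹ N (0∣⇒≡0 (∈𝒟⇒∣ t∈𝒟)) })

gcd[m,n]≢0ʳ : ∀ m n .{{_ : NonZero n}} → NonZero (gcd m n)
gcd[m,n]≢0ʳ m n = ℕ.≢-nonZero (gcd[m,n]≢0 m n (inj₂ (ℕ.≢-nonZero⁻¹ n)))

gcd[m*m,n]∣gcd[n,m]² : ∀ m n → gcd (m * m) n ∣ gcd n m * gcd n m
gcd[m*m,n]∣gcd[n,m]² m n = subst (G ∣_) (sym (c*gcd[m,n]≡gcd[cm,cn] g n m)) (gcd-greatest G∣g*n G∣g*m)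
  where
  G g : ℕ
  G = gcd (m * m) n
  g = gcd n m
  G∣n : G ∣ n
  G∣n = gcd[m,n]∣n (m * m) n
  G∣g*n : G ∣ g * n
  G∣g*n = subst (G ∣_) (trans (sym (c*gcd[m,n]≡gcd[cm,cn] n n m)) (ℕ.*-comm n g))
                (gcd-greatest (∣m⇒∣m*n n G∣n) (∣m⇒∣m*n m G∣n))
  G∣g*m : G ∣ g * m
  G∣g*m = subst (G ∣_) (trans (sym (c*gcd[m,n]≡gcd[cm,cn] m n m)) (ℕ.*-comm m g))
                (gcd-greatest (∣n⇒∣m*n m G∣n) (gcd[m,n]∣m (m * m) n))

gcd[m,k*n]∣k*gcd[m,n] : ∀ m k n → gcd m (k * n) ∣ k * gcd m n
gcd[m,k*n]∣k*gcd[m,n] m k n = subst (gcd m (k * n) ∣_) (sym (c*gcd[m,n]≡gcd[cm,cn] k m n))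
  (gcd-greatest (∣n⇒∣m*n k (gcd[m,n]∣m m (k * n))) (gcd[m,n]∣n m (k * n)))

applyUpTo-+ : ∀ (f : ℕ → I) m n → applyUpTo f (m + n) ≡ applyUpTo f m ++ applyUpTo (f ∘ (_+_ m)) n
applyUpTo-+ f zero    n = refl
applyUpTo-+ f (suc m) n = cong (f 0 ∷_) (applyUpTo-+ (f ∘ suc) m n)

one-multiple-per-block : ∀ k o .{{_ : NonZero k}} → k ∣ o →
                         ∑ (upTo k) (λ i → 𝟙 (k ∣? o + suc i)) ≡ 1ℚ
one-multiple-per-block (suc k) o k∣o =
  trans (∑-single (Unique.upTo⁺ (suc k)) (∈-upTo⁺ (ℕ.n<1+n k)) others)
        (𝟙-yes (suc k ∣? o + suc k) (∣m∣n⇒∣m+n k∣o ∣-refl))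
  where
  others : ∀ i → i ∈ upTo (suc k) → i ≢ k → 𝟙 (suc k ∣? o + suc i) ≡ 0ℚ
  others i i∈ i≢k = 𝟙-no (suc k ∣? o + suc i) λ k+1∣o+i+1 →
    i≢k (ℕ.≤-antisym (ℕ.≤-pred (∈-upTo⁻ i∈)) (ℕ.≤-pred (∣⇒≤ (∣m+n∣m⇒∣n k+1∣o+i+1 k∣o))))

count-multiples : ∀ k g o .{{_ : NonZero k}} → k ∣ o →
                  ∑ (upTo (g * k)) (λ i → 𝟙 (k ∣? o + suc i)) ≡ ℕtoℚ g
count-multiples k zero    o k∣o = refl
count-multiples k (suc g) o k∣o = begin
  ∑ (upTo (k + g * k)) f                            ≡⟨ cong (λ l → ∑ l f) (applyUpTo-+ (λ i → i) k (g * k)) ⟩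
  ∑ (upTo k ++ applyUpTo (_+_ k) (g * k)) f         ≡⟨ ∑-++ (upTo k) _ f ⟩
  ∑ (upTo k) f ℚ.+ ∑ (applyUpTo (_+_ k) (g * k)) f  ≡⟨ cong₂ ℚ._+_ (one-multiple-per-block k o k∣o) shifted ⟩
  1ℚ ℚ.+ ℕtoℚ g                                     ≡⟨ ℕtoℚ-homo-+ 1 g ⟨
  ℕtoℚ (suc g)                                      ∎
  where
  f : ℕ → ℚ
  f i = 𝟙 (k ∣? o + suc i)
  shifted : ∑ (applyUpTo (_+_ k) (g * k)) f ≡ ℕtoℚ g
  shifted = begin
    ∑ (applyUpTo (_+_ k) (g * k)) f                    ≡⟨ cong (λ l → ∑ l f) (List.map-upTo (_+_ k) (g * k)) ⟨
    ∑ (map (_+_ k) (upTo (g * k))) f                   ≡⟨ ∑-map (_+_ k) (upTo (g * k)) f ⟩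
    ∑ (upTo (g * k)) (λ i → f (k + i))                 ≡⟨ ∑-cong (upTo (g * k)) (λ i _ →
                                                            cong (λ n → 𝟙 (k ∣? n)) (reassoc i)) ⟩
    ∑ (upTo (g * k)) (λ i → 𝟙 (k ∣? (o + k) + suc i))  ≡⟨ count-multiples k g (o + k) k∣o+k ⟩
    ℕtoℚ g                                             ∎
    where
    k∣o+k : k ∣ o + k
    k∣o+k = ∣m∣n⇒∣m+n k∣o ∣-refl
    reassoc : ∀ i → o + suc (k + i) ≡ (o + k) + suc i
    reassoc i = trans (cong (_+_ o) (sym (ℕ.+-suc k i))) (sym (ℕ.+-assoc o k (suc i)))

-- ker𝟙 N t z indicates t (z + 1) ≡ 0 (mod N); for divisors t, d of N the inner product of these
-- vectors over z < N is gcd(t, d).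
ker𝟙 : ℕ → ℕ → ℕ → ℚ
ker𝟙 N t z = 𝟙 (N ∣? t * suc z)

ker𝟙-count : ∀ N g .{{_ : NonZero N}} → g ∣ N → ∑ (upTo N) (ker𝟙 N g) ≡ ℕtoℚ g
ker𝟙-count N g (divides k N≡k*g) = begin
  ∑ (upTo N) (ker𝟙 N g)                        ≡⟨ ∑-cong (upTo N) (λ z _ →
                                                    𝟙-cong (N ∣? g * suc z) (k ∣? 0 + suc z) cancel uncancel) ⟩
  ∑ (upTo N) f                                 ≡⟨ cong (λ n → ∑ (upTo n) f) N≡g*k ⟩
  ∑ (upTo (g * k)) f                           ≡⟨ count-multiples k g 0 (k ∣0) ⟩
  ℕtoℚ g                                       ∎
  where
  f : ℕ → ℚ
  f z = 𝟙 (k ∣? 0 + suc z)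
  N≡g*k : N ≡ g * k
  N≡g*k = trans N≡k*g (ℕ.*-comm k g)
  instance
    k*g≢0 : NonZero (k * g)
    k*g≢0 = ℕ.≢-nonZero (λ k*g≡0 → ℕ.≢-nonZero⁻¹ N (trans N≡k*g k*g≡0))
    k≢0 : NonZero k
    k≢0 = ℕ.m*n≢0⇒m≢0 k
    g≢0 : NonZero g
    g≢0 = ℕ.m*n≢0⇒n≢0 k
  cancel : ∀ {z} → N ∣ g * suc z → k ∣ suc z
  cancel = *-cancelˡ-∣ g ∘ subst (_∣ _) N≡g*k
  uncancel : ∀ {z} → k ∣ suc z → N ∣ g * suc z
  uncancel = subst (_∣ _) (sym N≡g*k) ∘ *-monoʳ-∣ g

ker𝟙-*-ker𝟙 : ∀ N t d z → ker𝟙 N t z ℚ.* ker𝟙 N d z ≡ ker𝟙 N (gcd d t) z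
ker𝟙-*-ker𝟙 N t d z = 𝟙-* (N ∣? t * suc z) (N ∣? d * suc z) (N ∣? gcd d t * suc z)
  (λ N∣tz N∣dz → subst (N ∣_) gcd[dz,tz]≡gcd[d,t]z (gcd-greatest N∣dz N∣tz))
  (λ N∣gz → ∣-trans N∣gz (*-monoˡ-∣ (suc z) (gcd[m,n]∣n d t)))
  (λ N∣gz → ∣-trans N∣gz (*-monoˡ-∣ (suc z) (gcd[m,n]∣m d t)))
  where
  gcd[dz,tz]≡gcd[d,t]z : gcd (d * suc z) (t * suc z) ≡ gcd d t * suc z
  gcd[dz,tz]≡gcd[d,t]z = begin
    gcd (d * suc z) (t * suc z) ≡⟨ cong₂ gcd (ℕ.*-comm d (suc z)) (ℕ.*-comm t (suc z)) ⟩
    gcd (suc z * d) (suc z * t) ≡⟨ c*gcd[m,n]≡gcd[cm,cn] (suc z) d t ⟨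
    suc z * gcd d t             ≡⟨ ℕ.*-comm (suc z) (gcd d t) ⟩
    gcd d t * suc z             ∎

gcd-gram : ∀ N t d .{{_ : NonZero N}} → d ∣ N →
           ℕtoℚ (gcd d t) ≡ ∑ (upTo N) (λ z → ker𝟙 N t z ℚ.* ker𝟙 N d z)
gcd-gram N t d d∣N = trans (sym (ker𝟙-count N (gcd d t) (∣-trans (gcd[m,n]∣m d t) d∣N)))
                           (∑-cong (upTo N) (λ z _ → sym (ker𝟙-*-ker𝟙 N t d z)))

ker𝟙² : ℕ → ℕ → ℕ × ℕ → ℚ
ker𝟙² N t (z₁ , z₂) = ker𝟙 N t z₁ ℚ.* ker𝟙 N t z₂

gcd²-gram : ∀ N t d .{{_ : NonZero N}} → d ∣ N →
  ℕtoℚ (gcd d t * gcd d t) ≡ ∑ (cartesianProduct (upTo N) (upTo N)) (λ j → ker𝟙² N t j ℚ.* ker𝟙² N d j)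
gcd²-gram N t d d∣N = begin
  ℕtoℚ (gcd d t * gcd d t)                 ≡⟨ ℕtoℚ-homo-* (gcd d t) (gcd d t) ⟩
  ℕtoℚ (gcd d t) ℚ.* ℕtoℚ (gcd d t)        ≡⟨ cong₂ ℚ._*_ (gcd-gram N t d d∣N) (gcd-gram N t d d∣N) ⟩
  ∑ Z c ℚ.* ∑ Z c                          ≡⟨ ∑-*-∑ Z Z c c ⟩
  ∑ (cartesianProduct Z Z) (λ (z₁ , z₂) → c z₁ ℚ.* c z₂)
    ≡⟨ ∑-cong (cartesianProduct Z Z) (λ (z₁ , z₂) _ →
         solve 4 (λ a b p q → (a :* b) :* (p :* q) := (a :* p) :* (b :* q)) refl
               (ker𝟙 N t z₁) (ker𝟙 N d z₁) (ker𝟙 N t z₂) (ker𝟙 N d z₂)) ⟩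
  ∑ (cartesianProduct Z Z) (λ j → ker𝟙² N t j ℚ.* ker𝟙² N d j) ∎
  where
  open +-*-Solver
  Z : List ℕ
  Z = upTo N
  c : ℕ → ℚ
  c z = ker𝟙 N t z ℚ.* ker𝟙 N d z

ker𝟙-cofactor : ∀ N s q t → N ≡ suc q * s → ker𝟙 N t q ≡ 𝟙 (s ∣? t)
ker𝟙-cofactor N s q t N≡[1+q]s = 𝟙-cong (N ∣? t * suc q) (s ∣? t)
  (λ N∣t[1+q] → *-cancelˡ-∣ (suc q) (subst₂ _∣_ N≡[1+q]s (ℕ.*-comm t (suc q)) N∣t[1+q]))
  (λ s∣t → subst₂ _∣_ (sym N≡[1+q]s) (ℕ.*-comm (suc q) t) (*-monoʳ-∣ (suc q) s∣t))

upper-divisor-sums≡0⇒≡0 : ∀ N .{{_ : NonZero N}} (x : ℕ → ℚ) →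
  (∀ s → s ∈ 𝒟 N → ∑ (𝒟 N) (λ t → x t ℚ.* 𝟙 (s ∣? t)) ≡ 0ℚ) →
  ∀ s → s ∈ 𝒟 N → x s ≡ 0ℚ
upper-divisor-sums≡0⇒≡0 N x sums≡0 s s∈𝒟 = go (suc N) s s∈𝒟 (ℕ.m≤m+n (suc N) s)
  where
  -- Downward induction on s: x vanishes at the proper multiples of s, so the sum for s is x s.
  go : ∀ n s → s ∈ 𝒟 N → N < n + s → x s ≡ 0ℚ
  go zero    s s∈𝒟 N<s     = contradiction (∈𝒟⇒≤ s∈𝒟) (ℕ.<⇒≱ N<s)
  go (suc n) s s∈𝒟 N<1+n+s = begin
    x s                                  ≡⟨ ℚ.*-identityʳ (x s) ⟨
    x s ℚ.* 1ℚ                           ≡⟨ cong (x s ℚ.*_) (𝟙-yes (s ∣? s) ∣-refl) ⟨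
    x s ℚ.* 𝟙 (s ∣? s)                   ≡⟨ ∑-single (𝒟-unique N) s∈𝒟 others ⟨
    ∑ (𝒟 N) (λ t → x t ℚ.* 𝟙 (s ∣? t))   ≡⟨ sums≡0 s s∈𝒟 ⟩
    0ℚ                                   ∎
    where
    others : ∀ t → t ∈ 𝒟 N → t ≢ s → x t ℚ.* 𝟙 (s ∣? t) ≡ 0ℚ
    others t t∈𝒟 t≢s with s ∣? t
    ... | no _    = ℚ.*-zeroʳ (x t)
    ... | yes s∣t = trans (cong (ℚ._* 1ℚ) (go n t t∈𝒟 N<n+t)) (ℚ.*-zeroˡ 1ℚ)
      where
      s<t : s < t
      s<t = ℕ.≤∧≢⇒< (∣⇒≤ {{∈𝒟⇒nonZero t∈𝒟}} s∣t) (≢-sym t≢s)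
      N<n+t : N < n + t
      N<n+t = ℕ.<-≤-trans N<1+n+s (subst (_≤ n + t) (ℕ.+-suc n s) (ℕ.+-monoʳ-≤ n s<t))

gcd²-nondegenerate : ∀ N .{{_ : NonZero N}} (x : ℕ → ℚ) →
  (∀ t → t ∈ 𝒟 N → ∑ (𝒟 N) (λ d → ℕtoℚ (gcd d t * gcd d t) ℚ.* x d) ≡ 0ℚ) →
  ∀ d → d ∈ 𝒟 N → x d ≡ 0ℚ
gcd²-nondegenerate N x Γx≡0 = upper-divisor-sums≡0⇒≡0 N x upper-sums≡0
  where
  Z : List ℕ
  Z = upTo N
  W≡0 : ∀ j → j ∈ cartesianProduct Z Z → ∑ (𝒟 N) (λ t → x t ℚ.* ker𝟙² N t j) ≡ 0ℚ
  W≡0 = gram-kernel (𝒟 N) (cartesianProduct Z Z) (ker𝟙² N) x λ t t∈𝒟 →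
    trans (∑-cong (𝒟 N) (λ d d∈𝒟 → cong (ℚ._* x d) (sym (gcd²-gram N t d (∈𝒟⇒∣ d∈𝒟)))))
          (Γx≡0 t t∈𝒟)
  upper-sums≡0 : ∀ s → s ∈ 𝒟 N → ∑ (𝒟 N) (λ t → x t ℚ.* 𝟙 (s ∣? t)) ≡ 0ℚ
  upper-sums≡0 s s∈𝒟 with ∈𝒟⇒∣ s∈𝒟
  ... | divides zero    N≡0       = contradiction N≡0 (ℕ.≢-nonZero⁻¹ N)
  ... | divides (suc q) N≡[1+q]s =
    trans (∑-cong (𝒟 N) (λ t _ → cong (x t ℚ.*_) (sym (diagonal t))))
          (W≡0 (q , q) (∈-cartesianProduct⁺ q∈Z q∈Z))
    where
    q∈Z : q ∈ Z
    q∈Z = ∈-upTo⁺ (∣⇒≤ (divides s (trans N≡[1+q]s (ℕ.*-comm (suc q) s))))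
    diagonal : ∀ t → ker𝟙² N t (q , q) ≡ 𝟙 (s ∣? t)
    diagonal t = trans (cong₂ ℚ._*_ (ker𝟙-cofactor N s q t N≡[1+q]s) (ker𝟙-cofactor N s q t N≡[1+q]s))
                       (𝟙-* (s ∣? t) (s ∣? t) (s ∣? t) (λ s∣t _ → s∣t) (λ s∣t → s∣t) (λ s∣t → s∣t))

-- The matrix A_N

A-denominator∣numerator : ∀ N t d → d ∣ N → d * gcd (t * t) N ∣ N * (gcd d t * gcd d t)
A-denominator∣numerator N t d (divides k refl) =
  subst (d * gcd (t * t) (k * d) ∣_) (trans (sym (ℕ.*-assoc d k (g * g))) (cong (_* (g * g)) (ℕ.*-comm d k)))
        (*-monoʳ-∣ d (∣-trans (gcd[m,k*n]∣k*gcd[m,n] (t * t) k d) (*-monoʳ-∣ k (gcd[m*m,n]∣gcd[n,m]² t d))))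
  where
  g : ℕ
  g = gcd d t

A-integral : ∀ N t d .{{_ : NonZero N}} → d ∈ 𝒟 N → ∃[ q ] A N t d ≡ ℕtoℚ q
A-integral N t d d∈𝒟 with A-denominator∣numerator N t d (∈𝒟⇒∣ d∈𝒟)
... | divides q eq = q , trans (cong (_// (d * gcd (t * t) N)) eq) (*//-cancelʳ q (d * gcd (t * t) N))
  where instance
    dG≢0 : NonZero (d * gcd (t * t) N)
    dG≢0 = ℕ.m*n≢0 d (gcd (t * t) N) {{∈𝒟⇒nonZero d∈𝒟}} {{gcd[m,n]≢0ʳ (t * t) N}}

Aapply-integral : ∀ N s .{{_ : NonZero N}} (Y : Vecℤ) → IsIntegral (Aapply N (ℤtoℚ ∘ Y) s)
Aapply-integral N s Y = ∑-integral (𝒟 N) λ d d∈𝒟 →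
  let q , A≡q = A-integral N s d d∈𝒟 in
  + q ℤ.* Y d , trans (cong (ℚ._* ℤtoℚ (Y d)) A≡q) (sym (ℤtoℚ-homo-* (+ q) (Y d)))

A-factor : ∀ N t d .{{_ : NonZero N}} → d ∈ 𝒟 N →
           A N t d ≡ (N // gcd (t * t) N) ℚ.* (ℕtoℚ (gcd d t * gcd d t) ℚ.* (1 // d))
A-factor N t d d∈𝒟 = begin
  (N * g²) // (d * G)                 ≡⟨ cong₂ _//_ (cong (N *_) (sym (ℕ.*-identityʳ g²))) (ℕ.*-comm d G) ⟩
  (N * (g² * 1)) // (G * d)           ≡⟨ //-* N (g² * 1) G d ⟩
  (N // G) ℚ.* ((g² * 1) // d)        ≡⟨ cong (λ e → (N // G) ℚ.* ((g² * 1) // e)) (sym (ℕ.*-identityˡ d)) ⟩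
  (N // G) ℚ.* ((g² * 1) // (1 * d))  ≡⟨ cong ((N // G) ℚ.*_) (//-* g² 1 1 d) ⟩
  (N // G) ℚ.* (ℕtoℚ g² ℚ.* (1 // d)) ∎
  where
  G g² : ℕ
  G  = gcd (t * t) N
  g² = gcd d t * gcd d t
  instance
    d≢0 : NonZero d
    d≢0 = ∈𝒟⇒nonZero d∈𝒟
    G≢0 : NonZero G
    G≢0 = gcd[m,n]≢0ʳ (t * t) N

Aapply-cong : ∀ N s {u w} → (∀ d → d ∈ 𝒟 N → u d ≡ w d) → Aapply N u s ≡ Aapply N w s
Aapply-cong N s u≗w = ∑-cong (𝒟 N) (λ d d∈𝒟 → cong (A N s d ℚ.*_) (u≗w d d∈𝒟))

Aapply-+ : ∀ N s u w → Aapply N (λ d → u d ℚ.+ w d) s ≡ Aapply N u s ℚ.+ Aapply N w s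
Aapply-+ N s u w = trans (∑-cong (𝒟 N) (λ d _ → ℚ.*-distribˡ-+ (A N s d) (u d) (w d))) (∑-+ (𝒟 N) _ _)

Aapply-*ˡ : ∀ N s c u → Aapply N (λ d → c ℚ.* u d) s ≡ c ℚ.* Aapply N u s
Aapply-*ˡ N s c u = trans (∑-cong (𝒟 N) (λ d _ →
                              solve 3 (λ a c x → a :* (c :* x) := c :* (a :* x)) refl (A N s d) c (u d)))
                          (∑-*ˡ (𝒟 N) c _)
  where open +-*-Solver

Aapply-injective : ∀ N .{{_ : NonZero N}} (u : ℕ → ℚ) →
  (∀ t → t ∈ 𝒟 N → Aapply N u t ≡ 0ℚ) → ∀ d → d ∈ 𝒟 N → u d ≡ 0ℚ
Aapply-injective N u Au≡0 d d∈𝒟 =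
  p≢0∧p*q≡0⇒q≡0 (//-nonzero 1 d) (gcd²-nondegenerate N x Γx≡0 d d∈𝒟)
  where
  open +-*-Solver
  instance
    d≢0 : NonZero d
    d≢0 = ∈𝒟⇒nonZero d∈𝒟
  x : ℕ → ℚ
  x d = (1 // d) ℚ.* u d
  Γx≡0 : ∀ t → t ∈ 𝒟 N → ∑ (𝒟 N) (λ d → ℕtoℚ (gcd d t * gcd d t) ℚ.* x d) ≡ 0ℚ
  Γx≡0 t t∈𝒟 = p≢0∧p*q≡0⇒q≡0 (//-nonzero N G) (begin
    (N // G) ℚ.* ∑ (𝒟 N) (λ d → ℕtoℚ (gcd d t * gcd d t) ℚ.* x d)
      ≡⟨ ∑-*ˡ (𝒟 N) (N // G) _ ⟨
    ∑ (𝒟 N) (λ d → (N // G) ℚ.* (ℕtoℚ (gcd d t * gcd d t) ℚ.* x d))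
      ≡⟨ ∑-cong (𝒟 N) (λ d d∈𝒟 → regroup d (A-factor N t d d∈𝒟)) ⟩
    Aapply N u t
      ≡⟨ Au≡0 t t∈𝒟 ⟩
    0ℚ ∎)
    where
    G : ℕ
    G = gcd (t * t) N
    instance
      G≢0 : NonZero G
      G≢0 = gcd[m,n]≢0ʳ (t * t) N
    regroup : ∀ d → A N t d ≡ (N // G) ℚ.* (ℕtoℚ (gcd d t * gcd d t) ℚ.* (1 // d)) →
              (N // G) ℚ.* (ℕtoℚ (gcd d t * gcd d t) ℚ.* x d) ≡ A N t d ℚ.* u d
    regroup d A≡ = trans (solve 4 (λ a b c v → a :* (b :* (c :* v)) := (a :* (b :* c)) :* v) refl
                                  (N // G) (ℕtoℚ (gcd d t * gcd d t)) (1 // d) (u d))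
                         (cong (ℚ._* u d) (sym A≡))

Aapply-scaled-column : ∀ N t c (v w : ℕ → ℚ) → IsInvColumn N t v →
  (∀ d → d ∈ 𝒟 N → w d ≡ c ℚ.* v d) → ∀ s → s ∈ 𝒟 N → Aapply N w s ≡ c ℚ.* δ s t
Aapply-scaled-column N t c v w inv w≡cv s s∈𝒟 =
  trans (Aapply-cong N s w≡cv) (trans (Aapply-*ˡ N s c v) (cong (c ℚ.*_) (inv s s∈𝒟)))

supported-at⇒scaled-column : ∀ N t .{{_ : NonZero N}} (v w : ℕ → ℚ) → IsInvColumn N t v →
  (∀ s → s ∈ 𝒟 N → s ≢ t → Aapply N w s ≡ 0ℚ) → ∀ d → d ∈ 𝒟 N → w d ≡ Aapply N w t ℚ.* v d
supported-at⇒scaled-column N t v w inv w-off d d∈𝒟 = begin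
  w d                    ≡⟨ solve 3 (λ w a v → w := (w :+ (:- a) :* v) :+ a :* v) refl (w d) a (v d) ⟩
  u d ℚ.+ a ℚ.* v d      ≡⟨ cong (ℚ._+ a ℚ.* v d) (Aapply-injective N u Au≡0 d d∈𝒟) ⟩
  0ℚ ℚ.+ a ℚ.* v d       ≡⟨ ℚ.+-identityˡ (a ℚ.* v d) ⟩
  a ℚ.* v d              ∎
  where
  open +-*-Solver
  a : ℚ
  a = Aapply N w t
  u : ℕ → ℚ
  u d = w d ℚ.+ (ℚ.- a) ℚ.* v d
  Au≡0 : ∀ s → s ∈ 𝒟 N → Aapply N u s ≡ 0ℚ
  Au≡0 s s∈𝒟 = begin
    Aapply N u s                                         ≡⟨ Aapply-+ N s w (λ d → (ℚ.- a) ℚ.* v d) ⟩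
    Aapply N w s ℚ.+ Aapply N (λ d → (ℚ.- a) ℚ.* v d) s  ≡⟨ cong (Aapply N w s ℚ.+_) (Aapply-*ˡ N s (ℚ.- a) v) ⟩
    Aapply N w s ℚ.+ (ℚ.- a) ℚ.* Aapply N v s
      ≡⟨ cong (λ e → Aapply N w s ℚ.+ (ℚ.- a) ℚ.* e) (inv s s∈𝒟) ⟩
    Aapply N w s ℚ.+ (ℚ.- a) ℚ.* δ s t                   ≡⟨ cancel (s ℕ.≟ t) ⟩
    0ℚ                                                   ∎
    where
    cancel : Dec (s ≡ t) → Aapply N w s ℚ.+ (ℚ.- a) ℚ.* δ s t ≡ 0ℚ
    cancel (yes refl) = trans (cong (λ e → a ℚ.+ (ℚ.- a) ℚ.* e) (δ-diag s))
                              (solve 1 (λ a → a :+ (:- a) :* con 1ℚ := con 0ℚ) refl a)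
    cancel (no s≢t)   = trans (cong₂ (λ e f → e ℚ.+ (ℚ.- a) ℚ.* f) (w-off s s∈𝒟 s≢t) (δ-off s≢t))
                              (solve 1 (λ a → con 0ℚ :+ (:- a) :* con 0ℚ := con 0ℚ) refl a)

holomorphic-factor-bound : ∀ N t .{{_ : NonZero N}} → t ∈ 𝒟 N → (v : ℕ → ℚ) (m : ℕ) →
  IsInvColumn N t v → (∀ m′ → 1 ≤ m′ → IntegralMultiple N v m′ → m ≤ m′) →
  (Y : Vecℤ) → Holomorphic N Y → Nonconstant N Y →
  (∀ s → s ∈ 𝒟 N → s ≢ t → Aapply N (ℤtoℚ ∘ Y) s ≡ 0ℚ) →
  ∃[ a ] Aapply N (ℤtoℚ ∘ Y) t ≡ ℕtoℚ a × m ≤ a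
holomorphic-factor-bound N t t∈𝒟 v m inv minimal Y holY (d₀ , d₀∈𝒟 , Yd₀≢0) Y-off =
  bound (nonneg-integral⇒ℕ (Aapply-integral N t Y) (holY t t∈𝒟))
  where
  Y≡AYt*v : ∀ d → d ∈ 𝒟 N → ℤtoℚ (Y d) ≡ Aapply N (ℤtoℚ ∘ Y) t ℚ.* v d
  Y≡AYt*v = supported-at⇒scaled-column N t v (ℤtoℚ ∘ Y) inv Y-off
  bound : ∃[ a ] Aapply N (ℤtoℚ ∘ Y) t ≡ ℕtoℚ a → ∃[ a ] Aapply N (ℤtoℚ ∘ Y) t ≡ ℕtoℚ a × m ≤ a
  bound (zero , AYt≡0) = contradiction (ℤtoℚ-injective (begin
    ℤtoℚ (Y d₀)                      ≡⟨ Y≡AYt*v d₀ d₀∈𝒟 ⟩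
    Aapply N (ℤtoℚ ∘ Y) t ℚ.* v d₀  ≡⟨ cong (ℚ._* v d₀) AYt≡0 ⟩
    0ℚ ℚ.* v d₀                      ≡⟨ ℚ.*-zeroˡ (v d₀) ⟩
    ℤtoℚ (+ 0)                       ∎)) Yd₀≢0
  bound (suc a , AYt≡1+a) = suc a , AYt≡1+a , minimal (suc a) (s≤s z≤n) λ d d∈𝒟 →
    Y d , trans (cong (ℚ._* v d) (sym AYt≡1+a)) (sym (Y≡AYt*v d d∈𝒟))

scaled-column-irreducible : ∀ N t .{{_ : NonZero N}} → t ∈ 𝒟 N → (v : ℕ → ℚ) (m : ℕ) → 1 ≤ m →
  IsInvColumn N t v → (∀ m′ → 1 ≤ m′ → IntegralMultiple N v m′ → m ≤ m′) →
  (X : Vecℤ) → (∀ s → s ∈ 𝒟 N → Aapply N (ℤtoℚ ∘ X) s ≡ ℕtoℚ m ℚ.* δ s t) → ¬ Factorizable N X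
scaled-column-irreducible N t t∈𝒟 v m 1≤m inv minimal X AX≡mδ (Y , Z , X≡Y+Z , holY , holZ , ncY , ncZ) =
  let a , AYt≡a , m≤a = holomorphic-factor-bound N t t∈𝒟 v m inv minimal Y holY ncY
                          (λ s s∈𝒟 s≢t → p+q≡0⇒p≡0 (holY s s∈𝒟) (holZ s s∈𝒟) (AY+AZ≡0 s s∈𝒟 s≢t))
      b , AZt≡b , m≤b = holomorphic-factor-bound N t t∈𝒟 v m inv minimal Z holZ ncZ
                          (λ s s∈𝒟 s≢t → p+q≡0⇒q≡0 (holY s s∈𝒟) (holZ s s∈𝒟) (AY+AZ≡0 s s∈𝒟 s≢t))
      a+b≡m = ℕtoℚ-injective (trans (ℕtoℚ-homo-+ a b) (trans (cong₂ ℚ._+_ (sym AYt≡a) (sym AZt≡b)) AYt+AZt≡m))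
  in ℕ.<⇒≱ (subst (a <_) a+b≡m (ℕ.m<m+n a (ℕ.<-≤-trans 1≤m m≤b))) m≤a
  where
  AY AZ : ℕ → ℚ
  AY = Aapply N (ℤtoℚ ∘ Y)
  AZ = Aapply N (ℤtoℚ ∘ Z)
  AY+AZ≡mδ : ∀ s → s ∈ 𝒟 N → AY s ℚ.+ AZ s ≡ ℕtoℚ m ℚ.* δ s t
  AY+AZ≡mδ s s∈𝒟 = begin
    AY s ℚ.+ AZ s                                 ≡⟨ Aapply-+ N s (ℤtoℚ ∘ Y) (ℤtoℚ ∘ Z) ⟨
    Aapply N (λ d → ℤtoℚ (Y d) ℚ.+ ℤtoℚ (Z d)) s  ≡⟨ Aapply-cong N s (λ d d∈𝒟 →
                                                       trans (sym (ℤtoℚ-homo-+ (Y d) (Z d)))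
                                                             (cong ℤtoℚ (sym (X≡Y+Z d d∈𝒟)))) ⟩
    Aapply N (ℤtoℚ ∘ X) s                         ≡⟨ AX≡mδ s s∈𝒟 ⟩
    ℕtoℚ m ℚ.* δ s t                              ∎
  AY+AZ≡0 : ∀ s → s ∈ 𝒟 N → s ≢ t → AY s ℚ.+ AZ s ≡ 0ℚ
  AY+AZ≡0 s s∈𝒟 s≢t =
    trans (AY+AZ≡mδ s s∈𝒟) (trans (cong (ℕtoℚ m ℚ.*_) (δ-off s≢t)) (ℚ.*-zeroʳ (ℕtoℚ m)))
  AYt+AZt≡m : AY t ℚ.+ AZ t ≡ ℕtoℚ m
  AYt+AZt≡m =
    trans (AY+AZ≡mδ t t∈𝒟) (trans (cong (ℕtoℚ m ℚ.*_) (δ-diag t)) (ℚ.*-identityʳ (ℕtoℚ m)))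

lemma6 : (N : ℕ) → 1 ≤ N → (t : ℕ) → t ∈ 𝒟 N → (X : Vecℤ) → IsB N t X →
    Holomorphic N X × ¬ Factorizable N X
lemma6 N 1≤N t t∈𝒟 X (v , m , inv , (1≤m , _ , minimal) , X≡mv) =
  holomorphic , scaled-column-irreducible N t t∈𝒟 v m 1≤m inv minimal X AX≡mδ
  where
  instance
    N≢0 : NonZero N
    N≢0 = ℕ.>-nonZero 1≤N
  AX≡mδ : ∀ s → s ∈ 𝒟 N → Aapply N (ℤtoℚ ∘ X) s ≡ ℕtoℚ m ℚ.* δ s t
  AX≡mδ = Aapply-scaled-column N t (ℕtoℚ m) v (ℤtoℚ ∘ X) inv X≡mv
  holomorphic : Holomorphic N X
  holomorphic s s∈𝒟 = subst (0ℚ ℚ.≤_) (sym (AX≡mδ s s∈𝒟)) (0≤p*q (//-nonneg m 1) (δ-nonneg s t))
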